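{- For every integer $c\ge 2$ and every integer $n\ge 2$, $\vec{d}(n,c)\ge d(n,c)\ge \frac1c\left(\log_c n-\log_c\log_c n\right)$.
   Context: All graphs and digraphs are simple. A $c$-edge-colored (di)graph is one with a fixed, not necessarily proper, coloring $\chi$ of its edges (arcs) by colors $1,\dots,c$. A sub(di)graph $H$ is properly colored if no vertex of $H$ is incident to two edges (arcs) of $H$ of the same color; cycles in digraphs are directed cycles. For an undirected $c$-edge-colored graph $G$, $\delta_{mon}(G)=\min_{x,i} d_i(x)$ where $d_i(x)$ is the number of edges of color $i$ incident with $x$. For a $c$-edge-colored digraph $D$, $\delta^+_{mon}(D)=\min_{x,i} d_i^+(x)$ where $d^+_i(x)$ is the number of arcs of color $i$ with tail $x$. $d(n,c)$ is the minimum $k$ such that every $c$-edge-colored undirected graph of order $n$ with $\delta_{mon}\ge k$ has a properly colored cycle; $\vec{d}(n,c)$ is the minimum $k$ such that every $c$-edge-colored digraph of order $n$ with $\delta^+_{mon}\ge k$ has a properly colored (directed) cycle. -}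

module Defs where

open import Data.Nat using (ℕ; zero; suc; _+_; _*_; _^_; _≤_; NonZero)
open import Data.Nat.DivMod using (_mod_)
open import Data.Fin using (Fin; toℕ)
open import Data.Fin.Properties using (_≟_)
open import Data.Maybe using (Maybe; just; nothing)
open import Data.Product using (Σ; _×_)
open import Data.List using (List; allFin)
open import Relation.Binary.PropositionalEquality using (_≡_; _≢_)
open import Relation.Nullary using (does)
open import Function.Definitions using (Injective)

-- Colors are Fin c (color i+1 of the paper is Fin index i).
-- col x y = nothing : no edge/arc; col x y = just i : edge/arc of color i.

record ColGraph (n c : ℕ) : Set where
  field
    col   : Fin n → Fin n → Maybe (Fin c)
    loopless : ∀ x → col x x ≡ nothing
    symmetric : ∀ x y → col x y ≡ col y x

-- In a digraph, col x y is the color of the arc x → y (if present).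
-- Both arcs x→y and y→x may be present (simple digraph: no loops,
-- no parallel arcs).
record ColDigraph (n c : ℕ) : Set where
  field
    col   : Fin n → Fin n → Maybe (Fin c)
    loopless : ∀ x → col x x ≡ nothing

countCol : ∀ {n c} → (Fin n → Maybe (Fin c)) → Fin c → List (Fin n) → ℕ
countCol f i List.[] = 0
countCol f i (y List.∷ ys) with f y
... | nothing = countCol f i ys
... | just j  = (if does (j ≟ i) then 1 else 0) + countCol f i ys
  where open import Data.Bool using (if_then_else_)

degU : ∀ {n c} → ColGraph n c → Fin n → Fin c → ℕ
degU G x i = countCol (ColGraph.col G x) i (allFin _)

outDeg : ∀ {n c} → ColDigraph n c → Fin n → Fin c → ℕ
outDeg D x i = countCol (ColDigraph.col D x) i (allFin _)

MonDegAtLeast : ∀ {n c} → ColGraph n c → ℕ → Set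
MonDegAtLeast G k = ∀ x i → k ≤ degU G x i

MonOutDegAtLeast : ∀ {n c} → ColDigraph n c → ℕ → Set
MonOutDegAtLeast D k = ∀ x i → k ≤ outDeg D x i

next : ∀ {m} → Fin (suc m) → Fin (suc m)
next {m} j = suc (toℕ j) mod suc m

HasPCCycle : ∀ {n c} → ColGraph n c → Set
HasPCCycle {n} {c} G =
  Σ ℕ λ k → Σ (Fin (3 + k) → Fin n) λ v → Injective _≡_ _≡_ v ×
  Σ (Fin (3 + k) → Fin c) λ cl →
    (∀ j → ColGraph.col G (v j) (v (next j)) ≡ just (cl j)) ×
    (∀ j → cl j ≢ cl (next j))

HasPCDiCycle : ∀ {n c} → ColDigraph n c → Set
HasPCDiCycle {n} {c} D =
  Σ ℕ λ k → Σ (Fin (2 + k) → Fin n) λ v → Injective _≡_ _≡_ v ×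
  Σ (Fin (2 + k) → Fin c) λ cl →
    (∀ j → ColDigraph.col D (v j) (v (next j)) ≡ just (cl j)) ×
    (∀ j → cl j ≢ cl (next j))

-- k is admissible in the definition of d(n,c)
UProp : ℕ → ℕ → ℕ → Set
UProp n c k = (G : ColGraph n c) → MonDegAtLeast G k → HasPCCycle G

-- k is admissible in the definition of d⃗(n,c)
DProp : ℕ → ℕ → ℕ → Set
DProp n c k = (D : ColDigraph n c) → MonOutDegAtLeast D k → HasPCDiCycle D

IsMinimum : (ℕ → Set) → ℕ → Set
IsMinimum P k = P k × (∀ j → P j → k ≤ j)

-- For c ≥ 2, n ≥ 2 and natural d:
--   d ≥ (1/c)(log_c n − log_c log_c n)   ⟺   c ^ n ≤ n ^ (c ^ (c * d))
--
LogBound : ℕ → ℕ → ℕ → Set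
LogBound c n d = c ^ n ≤ n ^ (c ^ (c * d))

-- Lower bound by an explicit graph without properly coloured cycles. Its vertices are the words
-- over the c colours in which every letter occurs at most d times; two words are adjacent iff one
-- is a proper prefix of the other, and the edge gets the letter that follows the shorter word.
-- A word w has a colour-i neighbour for each occurrence of i in w (the prefix before it) and can
-- be extended by i as often as the bound allows, so every colour degree is at least d. On a cycle,
-- let u be the shortest word and a the colour of the cycle edge leaving it: every word of the cycle
-- other than u extends u ++ [ a ], so the edge returning to u also has colour a. There are fewer
-- than 2 c^(cd) such words, hence minimality of d forces n < 2 c^(cd), which is the logarithmic
-- bound. Reading any graph as a symmetric digraph gives d(n,c) ≤ d⃗(n,c).

module Submission where

open import Defs
open import Data.Nat using (ℕ; _≤_)
open import Data.Product using (_×_)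

open import Data.Bool using (if_then_else_)
open import Data.Empty using (⊥; ⊥-elim)
open import Data.Fin using (Fin; zero; suc; toℕ; inject≤)
open import Data.Fin.Properties using (_≟_; all?; toℕ-fromℕ<; toℕ-injective; toℕ<n; toℕ-inject≤)
open import Data.List using (List; []; _∷_; [_]; _++_; length; map; cartesianProductWith; allFin; filter; deduplicate)
open import Data.List.Extrema.Nat using (argmax; argmax-all; f[xs]≤f[argmax]; argmin; f[argmin]≤f[xs])
open import Data.List.Membership.Propositional using (_∈_)
open import Data.List.Membership.Propositional.Properties
  using (∈-∃++; ∈-++⁻; ∈-++⁺ˡ; ∈-++⁺ʳ; ∈-allFin; ∈-cartesianProductWith⁺;
         ∈-filter⁺; ∈-filter⁻; ∈-deduplicate⁺; ∈-deduplicate⁻)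
open import Data.List.Properties
  using (∷-injective; ∷-injectiveˡ; ++-assoc; ≡-dec; length-++; length-++-≤ˡ; length-++-sucʳ;
         length-map; length-tabulate; length-filter; length-deduplicate)
open import Data.List.Relation.Unary.All as All using (All; []; _∷_)
import Data.List.Relation.Unary.All.Properties as All
open import Data.List.Relation.Unary.AllPairs as AllPairs using (AllPairs; []; _∷_)
import Data.List.Relation.Unary.AllPairs.Properties as AllPairs
open import Data.List.Relation.Unary.Any as Any using (here; there)
open import Data.List.Relation.Unary.Unique.DecPropositional.Properties using (deduplicate-!)
open import Data.List.Relation.Unary.Unique.Propositional using (Unique)
import Data.List.Relation.Unary.Unique.Propositional.Properties as Unique
open import Data.Maybe using (Maybe; just; nothing)
open import Data.Maybe.Properties using (just-injective)
open import Data.Nat using (zero; suc; _+_; _*_; _^_; _∸_; _<_; NonZero; >-nonZero; s≤s; z≤n)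
open import Data.Nat.DivMod using (_%_; %-distribˡ-+; m%n%n≡m%n; [m+n]%n≡m%n; m<n⇒m%n≡m; m%n<n)
open import Data.Nat.GeneralisedArithmetic using (fold)
open import Data.Nat.Properties hiding (_≟_)
open import Algebra.Properties.CommutativeMonoid.Sum +-0-commutativeMonoid
  using (sum-syntax; ∑-distrib-+; sum-replicate-zero)
open import Algebra.Properties.CommutativeSemigroup *-commutativeSemigroup using (x∙yz≈y∙xz)
open import Data.Product using (∃-syntax; _,_; proj₂)
open import Data.Sum as Sum using (_⊎_; inj₁; inj₂)
open import Function using (_∘_; id)
open import Relation.Binary.Definitions using (DecidableEquality)
open import Relation.Binary.PropositionalEquality
  using (_≡_; _≢_; refl; sym; trans; cong; cong₂; subst; module ≡-Reasoning)
open import Relation.Nullary using (Dec; yes; no; does; ¬_; contradiction)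
open import Relation.Nullary.Decidable using (decidable-stable)

n<2^n : ∀ n → n < 2 ^ n
n<2^n zero    = s≤s z≤n
n<2^n (suc n) = begin-strict
  1 + n         <⟨ +-mono-≤-< (m^n>0 2 n) (n<2^n n) ⟩
  2 ^ n + 2 ^ n ≡⟨ cong (2 ^ n +_) (+-identityʳ (2 ^ n)) ⟨
  2 ^ suc n     ∎
  where open ≤-Reasoning

n<2*c^[c*d]⇒logBound : ∀ {c n} d → 2 ≤ c → 2 ≤ n → n < 2 * c ^ (c * d) → LogBound c n d
n<2*c^[c*d]⇒logBound {c} zero 2≤c 2≤n n<2 rewrite *-zeroʳ c = contradiction n<2 (≤⇒≯ 2≤n)
n<2*c^[c*d]⇒logBound {c} {n} (suc d) 2≤c 2≤n n<2M = bound (c * c ≤? n) (c ≤? n)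
  where
  open ≤-Reasoning
  instance
    c≢0 : NonZero c
    c≢0 = >-nonZero (≤-trans (s≤s z≤n) 2≤c)

  M : ℕ
  M = c ^ (c * suc d)

  c*c≤M : c * c ≤ M
  c*c≤M = begin
    c * c ≡⟨ cong (c *_) (sym (*-identityʳ c)) ⟩
    c ^ 2 ≤⟨ ^-monoʳ-≤ c (≤-trans 2≤c (m≤m*n c (suc d))) ⟩
    M     ∎

  bound : Dec (c * c ≤ n) → Dec (c ≤ n) → c ^ n ≤ n ^ M
  bound (yes c*c≤n) _ = begin
    c ^ n       ≤⟨ ^-monoʳ-≤ c (<⇒≤ n<2M) ⟩
    c ^ (2 * M) ≡⟨ ^-*-assoc c 2 M ⟨
    (c ^ 2) ^ M ≡⟨ cong (λ x → (c * x) ^ M) (*-identityʳ c) ⟩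
    (c * c) ^ M ≤⟨ ^-monoˡ-≤ M c*c≤n ⟩
    n ^ M       ∎
  bound (no c*c≰n) (yes c≤n) = begin
    c ^ n       ≤⟨ ^-monoʳ-≤ c (≤-trans (<⇒≤ (≰⇒> c*c≰n)) c*c≤M) ⟩
    c ^ M       ≤⟨ ^-monoˡ-≤ M c≤n ⟩
    n ^ M       ∎
  bound (no _) (no c≰n) = begin
    c ^ n       ≤⟨ ^-monoʳ-≤ c (<⇒≤ (≰⇒> c≰n)) ⟩
    c ^ c       ≤⟨ ^-monoˡ-≤ c (<⇒≤ (n<2^n c)) ⟩
    (2 ^ c) ^ c ≡⟨ ^-*-assoc 2 c c ⟩
    2 ^ (c * c) ≤⟨ ^-monoʳ-≤ 2 c*c≤M ⟩
    2 ^ M       ≤⟨ ^-monoˡ-≤ M 2≤n ⟩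
    n ^ M       ∎

module _ {n c : ℕ} (f : Fin n → Maybe (Fin c)) (i : Fin c) where

  countCol-insert : ∀ xs {y} zs → f y ≡ just i → countCol f i (xs ++ y ∷ zs) ≡ suc (countCol f i (xs ++ zs))
  countCol-insert [] {y} zs fy≡i with f y | fy≡i
  ... | just .i | refl with i ≟ i
  ...   | yes _ = refl
  ...   | no i≢i = contradiction refl i≢i
  countCol-insert (x ∷ xs) zs fy≡i with f x
  ... | nothing = countCol-insert xs zs fy≡i
  ... | just j  = trans (cong (_ +_) (countCol-insert xs zs fy≡i)) (+-suc _ _)

  countCol-≥ : ∀ {xs ys} → Unique ys → All (_∈ xs) ys → All (λ y → f y ≡ just i) ys →
               length ys ≤ countCol f i xs
  countCol-≥ {ys = []} _ _ _ = z≤n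
  countCol-≥ {ys = y ∷ ys} (y∉ys ∷ unique) (y∈xs ∷ ys⊆xs) (fy≡i ∷ fys≡i)
    with xs₁ , xs₂ , refl ← ∈-∃++ y∈xs = begin
      suc (length ys)                 ≤⟨ s≤s (countCol-≥ unique (All.zipWith remove (y∉ys , ys⊆xs)) fys≡i) ⟩
      suc (countCol f i (xs₁ ++ xs₂)) ≡⟨ countCol-insert xs₁ xs₂ fy≡i ⟨
      countCol f i (xs₁ ++ y ∷ xs₂)   ∎
    where
    open ≤-Reasoning
    remove : ∀ {z} → y ≢ z × z ∈ xs₁ ++ y ∷ xs₂ → z ∈ xs₁ ++ xs₂
    remove (y≢z , z∈) with ∈-++⁻ xs₁ z∈
    ... | inj₁ z∈xs₁         = ∈-++⁺ˡ z∈xs₁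
    ... | inj₂ (here refl)   = contradiction refl y≢z
    ... | inj₂ (there z∈xs₂) = ∈-++⁺ʳ xs₁ z∈xs₂

module _ {m : ℕ} where

  toℕ-fold-next : ∀ (j : Fin (suc m)) t → toℕ (fold j next t) ≡ (toℕ j + t) % suc m
  toℕ-fold-next j zero = sym (trans (cong (_% suc m) (+-identityʳ (toℕ j))) (m<n⇒m%n≡m (toℕ<n j)))
  toℕ-fold-next j (suc t) = begin
    toℕ (next (fold j next t))    ≡⟨ toℕ-fromℕ< (m%n<n (suc (toℕ (fold j next t))) (suc m)) ⟩
    (1 + toℕ (fold j next t)) % M ≡⟨ cong (λ z → (1 + z) % M) (toℕ-fold-next j t) ⟩
    (1 + x % M) % M               ≡⟨ %-distribˡ-+ 1 (x % M) M ⟩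
    (1 % M + x % M % M) % M       ≡⟨ cong (λ z → (1 % M + z) % M) (m%n%n≡m%n x M) ⟩
    (1 % M + x % M) % M           ≡⟨ %-distribˡ-+ 1 x M ⟨
    (1 + x) % M                   ≡⟨ cong (_% M) (+-suc (toℕ j) t) ⟨
    (toℕ j + suc t) % M           ∎
    where
    open ≡-Reasoning
    M = suc m
    x = toℕ j + t

  fold-next-full : ∀ (j : Fin (suc m)) → fold j next (suc m) ≡ j
  fold-next-full j = toℕ-injective (begin
    toℕ (fold j next (suc m)) ≡⟨ toℕ-fold-next j (suc m) ⟩
    (toℕ j + suc m) % suc m   ≡⟨ [m+n]%n≡m%n (toℕ j) (suc m) ⟩
    toℕ j % suc m             ≡⟨ m<n⇒m%n≡m (toℕ<n j) ⟩
    toℕ j                     ∎)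
    where open ≡-Reasoning

  predecessor-reachable : {P : Fin (suc m) → Set} → ∀ j → P j → (∀ i → P i → P (next i)) →
                          ∃[ p ] next p ≡ j × P p
  predecessor-reachable {P} j Pj P-next = fold j next m , fold-next-full j , iterate m
    where
    iterate : ∀ t → P (fold j next t)
    iterate zero    = Pj
    iterate (suc t) = P-next _ (iterate t)

∑-≤ : ∀ {k d} (f : Fin k → ℕ) → (∀ i → f i ≤ d) → ∑[ i < k ] f i ≤ k * d
∑-≤ {zero}  f f≤d = z≤n
∑-≤ {suc k} f f≤d = +-mono-≤ (f≤d zero) (∑-≤ (f ∘ suc) (f≤d ∘ suc))

δ : ∀ {c} → Fin c → Fin c → ℕ
δ a b = if does (a ≟ b) then 1 else 0

∑-δ : ∀ {c} (a : Fin c) → ∑[ i < c ] δ a i ≡ 1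
∑-δ {suc c} zero    = cong suc (sum-replicate-zero c)
∑-δ {suc c} (suc a) = ∑-δ a

length-cartesianProductWith : ∀ {A B C : Set} (f : A → B → C) xs ys →
  length (cartesianProductWith f xs ys) ≡ length xs * length ys
length-cartesianProductWith f []       ys = refl
length-cartesianProductWith f (x ∷ xs) ys = begin
  length (map (f x) ys ++ cartesianProductWith f xs ys)         ≡⟨ length-++ (map (f x) ys) ⟩
  length (map (f x) ys) + length (cartesianProductWith f xs ys) ≡⟨ cong₂ _+_ (length-map (f x) ys)
                                                                             (length-cartesianProductWith f xs ys) ⟩
  length ys + length xs * length ys                             ∎
  where open ≡-Reasoning

map-preimage : ∀ {A B : Set} (f : A → B) {zs} → All (λ z → ∃[ y ] f y ≡ z) zs → ∃[ ys ] map f ys ≡ zs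
map-preimage f []                       = [] , refl
map-preimage f ((y , refl) ∷ preimages) with ys , refl ← map-preimage f preimages = y ∷ ys , refl

nthOr : ∀ {A : Set} → A → List A → ℕ → A
nthOr d []       _       = d
nthOr d (x ∷ xs) zero    = x
nthOr d (x ∷ xs) (suc k) = nthOr d xs k

module _ {A : Set} (d : A) where

  nthOr-∈ : ∀ xs k → nthOr d xs k ∈ xs ⊎ nthOr d xs k ≡ d
  nthOr-∈ []       k       = inj₂ refl
  nthOr-∈ (x ∷ xs) zero    = inj₁ (here refl)
  nthOr-∈ (x ∷ xs) (suc k) = Sum.map₁ there (nthOr-∈ xs k)

  nthOr-beyond : ∀ xs {k} → length xs ≤ k → nthOr d xs k ≡ d
  nthOr-beyond []       _            = refl
  nthOr-beyond (x ∷ xs) (s≤s |xs|≤k) = nthOr-beyond xs |xs|≤k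

  nthOr-within : ∀ xs {k} → k < length xs → nthOr d xs k ∈ xs
  nthOr-within (x ∷ xs) {zero}  _            = here refl
  nthOr-within (x ∷ xs) {suc k} (s≤s k<|xs|) = there (nthOr-within xs k<|xs|)

  nthOr-index : ∀ {xs z} (z∈xs : z ∈ xs) → nthOr d xs (toℕ (Any.index z∈xs)) ≡ z
  nthOr-index (here refl) = refl
  nthOr-index (there z∈xs) = nthOr-index z∈xs

  nthOr-injective : ∀ {xs} → Unique xs → ∀ {k k′} → k < length xs → k′ < length xs →
                    nthOr d xs k ≡ nthOr d xs k′ → k ≡ k′
  nthOr-injective {x ∷ xs} _ {zero}  {zero}  _ _ _ = refl
  nthOr-injective {x ∷ xs} (x∉xs ∷ _) {zero} {suc k′} _ (s≤s k′<|xs|) x≡ =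
    contradiction (subst (_∈ xs) (sym x≡) (nthOr-within xs k′<|xs|)) (All.All¬⇒¬Any x∉xs)
  nthOr-injective {x ∷ xs} (x∉xs ∷ _) {suc k} {zero} (s≤s k<|xs|) _ ≡x =
    contradiction (subst (_∈ xs) ≡x (nthOr-within xs k<|xs|)) (All.All¬⇒¬Any x∉xs)
  nthOr-injective {x ∷ xs} (_ ∷ unique) {suc k} {suc k′} (s≤s k<) (s≤s k′<) eq =
    cong suc (nthOr-injective unique k< k′< eq)

Word : ℕ → Set
Word c = List (Fin c)

module _ {c : ℕ} where

  branch : Word c → Word c → Maybe (Fin c)
  branch []      []      = nothing
  branch []      (b ∷ _) = just b
  branch (a ∷ _) []      = just a
  branch (a ∷ u) (b ∷ w) with a ≟ b
  ... | yes _ = branch u w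
  ... | no  _ = nothing

  Extends : Word c → Fin c → Word c → Set
  Extends u a w = ∃[ r ] w ≡ u ++ a ∷ r

  branch-sym : ∀ u w → branch u w ≡ branch w u
  branch-sym []      []      = refl
  branch-sym []      (b ∷ w) = refl
  branch-sym (a ∷ u) []      = refl
  branch-sym (a ∷ u) (b ∷ w) with a ≟ b | b ≟ a
  ... | yes _   | yes _   = branch-sym u w
  ... | yes a≡b | no  b≢a = contradiction (sym a≡b) b≢a
  ... | no  a≢b | yes b≡a = contradiction (sym b≡a) a≢b
  ... | no  _   | no  _   = refl

  branch-self : ∀ u → branch u u ≡ nothing
  branch-self []      = refl
  branch-self (a ∷ u) with a ≟ a
  ... | yes _ = branch-self u
  ... | no  _ = refl

  branch-extension : ∀ {u a w} → Extends u a w → branch u w ≡ just a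
  branch-extension {[]}    (r , refl) = refl
  branch-extension {x ∷ u} (r , refl) with x ≟ x
  ... | yes _   = branch-extension {u} (r , refl)
  ... | no  x≢x = contradiction refl x≢x

  branch-extensionˡ : ∀ {u a w} → Extends u a w → branch w u ≡ just a
  branch-extensionˡ {u} {w = w} ext = trans (branch-sym w u) (branch-extension ext)

  branch-just : ∀ u w {a} → branch u w ≡ just a → Extends u a w ⊎ Extends w a u
  branch-just []      (b ∷ w) refl = inj₁ (w , refl)
  branch-just (a ∷ u) []      refl = inj₂ (u , refl)
  branch-just (a ∷ u) (b ∷ w) eq with a ≟ b
  branch-just (a ∷ u) (.a ∷ w) eq | yes refl =
    Sum.map (λ (r , e) → r , cong (a ∷_) e) (λ (r , e) → r , cong (a ∷_) e) (branch-just u w eq)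

  extends-longer : ∀ {u a w} → Extends u a w → length u < length w
  extends-longer {u} {a} (r , refl) = begin-strict
    length u            <⟨ s≤s (length-++-≤ˡ u) ⟩
    suc (length (u ++ r)) ≡⟨ length-++-sucʳ u a r ⟨
    length (u ++ a ∷ r) ∎
    where open ≤-Reasoning

  extends-trans : ∀ {u a v b w} → Extends u a v → Extends v b w → Extends u a w
  extends-trans {u} {a} {b = b} (r , refl) (s , refl) = r ++ b ∷ s , ++-assoc u (a ∷ r) (b ∷ s)

  prefixes-comparable : ∀ {u a v b w} → Extends u a w → Extends v b w → length u ≤ length v →
                        v ≡ u ⊎ Extends u a v
  prefixes-comparable {[]}    {v = []}    _          _          _ = inj₁ refl
  prefixes-comparable {[]}    {v = x ∷ v} (r , refl) (s , eq)   _ with refl ← ∷-injectiveˡ eq = inj₂ (v , refl)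
  prefixes-comparable {x ∷ u} {v = y ∷ v} (r , refl) (s , eq) (s≤s le) with refl , eq′ ← ∷-injective eq =
    Sum.map (cong (x ∷_)) (λ (t , e) → t , cong (x ∷_) e)
      (prefixes-comparable {u} (r , refl) (s , eq′) le)

  occurrences : Fin c → Word c → ℕ
  occurrences i []      = 0
  occurrences i (a ∷ w) = δ a i + occurrences i w

  occurrences-++ : ∀ i u v → occurrences i (u ++ v) ≡ occurrences i u + occurrences i v
  occurrences-++ i []      v = refl
  occurrences-++ i (a ∷ u) v = trans (cong (δ a i +_) (occurrences-++ i u v)) (sym (+-assoc (δ a i) _ _))

  length≡∑occurrences : ∀ w → length w ≡ ∑[ i < c ] occurrences i w
  length≡∑occurrences []      = sym (sum-replicate-zero c)
  length≡∑occurrences (a ∷ w) = begin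
    1 + length w                                  ≡⟨ cong₂ _+_ (∑-δ a) (sym (length≡∑occurrences w)) ⟨
    ∑[ i < c ] δ a i + ∑[ i < c ] occurrences i w ≡⟨ ∑-distrib-+ (δ a) (λ i → occurrences i w) ⟨
    ∑[ i < c ] (δ a i + occurrences i w)          ∎
    where open ≡-Reasoning

  LetterBounded : ℕ → Word c → Set
  LetterBounded d w = ∀ i → occurrences i w ≤ d

  letterBounded? : ∀ d w → Dec (LetterBounded d w)
  letterBounded? d w = all? (λ i → occurrences i w ≤? d)

  letterBounded-prefix : ∀ {d} u v → LetterBounded d (u ++ v) → LetterBounded d u
  letterBounded-prefix u v bounded i =
    ≤-trans (m≤m+n _ _) (≤-trans (≤-reflexive (sym (occurrences-++ i u v))) (bounded i))

  letterBounded⇒length≤ : ∀ {d} w → LetterBounded d w → length w ≤ c * d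
  letterBounded⇒length≤ w bounded =
    subst (_≤ _) (sym (length≡∑occurrences w)) (∑-≤ (λ i → occurrences i w) bounded)

  wordsUpTo : ℕ → List (Word c)
  wordsUpTo zero    = [] ∷ []
  wordsUpTo (suc L) = [] ∷ cartesianProductWith _∷_ (allFin c) (wordsUpTo L)

  ∈-wordsUpTo : ∀ {L} w → length w ≤ L → w ∈ wordsUpTo L
  ∈-wordsUpTo {zero}  []      _         = here refl
  ∈-wordsUpTo {suc L} []      _         = here refl
  ∈-wordsUpTo {suc L} (a ∷ w) (s≤s |w|≤L) =
    there (∈-cartesianProductWith⁺ _∷_ (∈-allFin a) (∈-wordsUpTo w |w|≤L))

  length-wordsUpTo : 2 ≤ c → ∀ L → length (wordsUpTo L) < 2 * c ^ L
  length-wordsUpTo 2≤c zero    = s≤s (s≤s z≤n)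
  length-wordsUpTo 2≤c (suc L) = begin-strict
    1 + length (cartesianProductWith _∷_ (allFin c) (wordsUpTo L))
      ≡⟨ cong suc (length-cartesianProductWith _∷_ (allFin c) (wordsUpTo L)) ⟩
    1 + length (allFin c) * N ≡⟨ cong (λ k → 1 + k * N) (length-tabulate {n = c} id) ⟩
    1 + c * N                 <⟨ +-monoˡ-≤ (c * N) 2≤c ⟩
    c + c * N                 ≡⟨ *-suc c N ⟨
    c * suc N                 ≤⟨ *-monoʳ-≤ c (length-wordsUpTo 2≤c L) ⟩
    c * (2 * c ^ L)           ≡⟨ x∙yz≈y∙xz c 2 (c ^ L) ⟩
    2 * c ^ suc L             ∎
    where
    open ≤-Reasoning
    N = length (wordsUpTo L)

  _≟ʷ_ : DecidableEquality (Word c)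
  _≟ʷ_ = ≡-dec _≟_

  boundedCandidates : ℕ → List (Word c)
  boundedCandidates d = filter (letterBounded? d) (wordsUpTo (c * d))

  boundedWords : ℕ → List (Word c)
  boundedWords d = deduplicate _≟ʷ_ (boundedCandidates d)

  module _ {d : ℕ} where

    ∈-boundedWords⁺ : ∀ {w} → LetterBounded d w → w ∈ boundedWords d
    ∈-boundedWords⁺ {w} bounded = ∈-deduplicate⁺ _≟ʷ_ (∈-filter⁺ (letterBounded? d) {xs = wordsUpTo (c * d)}
      (∈-wordsUpTo w (letterBounded⇒length≤ w bounded)) bounded)

    ∈-boundedWords⁻ : ∀ {w} → w ∈ boundedWords d → LetterBounded d w
    ∈-boundedWords⁻ w∈ = proj₂ (∈-filter⁻ (letterBounded? d) {xs = wordsUpTo (c * d)}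
      (∈-deduplicate⁻ _≟ʷ_ (boundedCandidates d) w∈))

    boundedWords-unique : Unique (boundedWords d)
    boundedWords-unique = deduplicate-! _≟ʷ_ (boundedCandidates d)

    length-boundedWords : 2 ≤ c → length (boundedWords d) < 2 * c ^ (c * d)
    length-boundedWords 2≤c = begin-strict
      length (boundedWords d)      ≤⟨ length-deduplicate _≟ʷ_ (boundedCandidates d) ⟩
      length (boundedCandidates d) ≤⟨ length-filter (letterBounded? d) (wordsUpTo (c * d)) ⟩
      length (wordsUpTo (c * d))   <⟨ length-wordsUpTo 2≤c (c * d) ⟩
      2 * c ^ (c * d)              ∎
      where open ≤-Reasoning

    longestBounded : Word c
    longestBounded = argmax length [] (boundedWords d)

    longestBounded-bounded : LetterBounded d longestBounded
    longestBounded-bounded = argmax-all length {P = LetterBounded d} (λ _ → z≤n) (All.tabulate ∈-boundedWords⁻)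

    longestBounded-maximal : ∀ {w} → LetterBounded d w → length w ≤ length longestBounded
    longestBounded-maximal {w} bounded =
      All.lookup (f[xs]≤f[argmax] {f = length} [] (boundedWords d)) (∈-boundedWords⁺ {w} bounded)

    longestBounded-unextendable : ∀ {a w} → LetterBounded d w → ¬ Extends longestBounded a w
    longestBounded-unextendable {w = w} bounded ext = <⇒≱ (extends-longer ext) (longestBounded-maximal {w} bounded)

  LengthIncreasing : List (Word c) → Set
  LengthIncreasing = AllPairs (λ u v → length u < length v)

  lengthIncreasing⇒unique : ∀ {us} → LengthIncreasing us → Unique us
  lengthIncreasing⇒unique = AllPairs.map (λ |u|<|v| u≡v → <-irrefl (cong length u≡v) |u|<|v|)

  extends-∷ : ∀ {u i w} (a : Fin c) → Extends u i w → Extends (a ∷ u) i (a ∷ w)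
  extends-∷ a (r , e) = r , cong (a ∷_) e

  lengthIncreasing-∷ : ∀ {us} a → LengthIncreasing us → LengthIncreasing (map (a ∷_) us)
  lengthIncreasing-∷ a increasing = AllPairs.map⁺ {f = a ∷_} (AllPairs.map s≤s increasing)

  prefixesBefore : Fin c → Word c → List (Word c)
  prefixesBefore i []      = []
  prefixesBefore i (a ∷ w) with a ≟ i
  ... | yes _ = [] ∷ map (a ∷_) (prefixesBefore i w)
  ... | no  _ = map (a ∷_) (prefixesBefore i w)

  length-prefixesBefore : ∀ i w → length (prefixesBefore i w) ≡ occurrences i w
  length-prefixesBefore i []      = refl
  length-prefixesBefore i (a ∷ w) with a ≟ i
  ... | yes _ = cong suc (trans (length-map (a ∷_) (prefixesBefore i w)) (length-prefixesBefore i w))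
  ... | no  _ = trans (length-map (a ∷_) (prefixesBefore i w)) (length-prefixesBefore i w)

  prefixesBefore-extends : ∀ i w → All (λ u → Extends u i w) (prefixesBefore i w)
  prefixesBefore-extends i []      = []
  prefixesBefore-extends i (a ∷ w) with a ≟ i
  ... | yes refl = (w , refl) ∷ All.map⁺ (All.map (extends-∷ a) (prefixesBefore-extends i w))
  ... | no  _    = All.map⁺ (All.map (extends-∷ a) (prefixesBefore-extends i w))

  prefixesBefore-increasing : ∀ i w → LengthIncreasing (prefixesBefore i w)
  prefixesBefore-increasing i []      = []
  prefixesBefore-increasing i (a ∷ w) with a ≟ i
  ... | yes _ = All.map⁺ (All.tabulate (λ _ → s≤s z≤n)) ∷ lengthIncreasing-∷ a (prefixesBefore-increasing i w)
  ... | no  _ = lengthIncreasing-∷ a (prefixesBefore-increasing i w)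

  occurrences-snoc : ∀ i w → occurrences i (w ++ [ i ]) ≡ suc (occurrences i w)
  occurrences-snoc i w with i ≟ i | occurrences-++ i w [ i ]
  ... | yes _   | eq = trans eq (+-comm (occurrences i w) 1)
  ... | no  i≢i | _  = contradiction refl i≢i

  letterBounded-snoc : ∀ {d} w i → LetterBounded d w → occurrences i w < d → LetterBounded d (w ++ [ i ])
  letterBounded-snoc w i bounded room j with i ≟ j | occurrences-++ j w [ i ]
  ... | yes refl | _  = subst (_≤ _) (sym (occurrences-snoc i w)) room
  ... | no  _    | eq = subst (_≤ _) (sym (trans eq (+-identityʳ _))) (bounded j)

  extensionsBy : Fin c → Word c → ℕ → List (Word c)
  extensionsBy i w zero    = []
  extensionsBy i w (suc k) = (w ++ [ i ]) ∷ extensionsBy i (w ++ [ i ]) k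

  length-extensionsBy : ∀ i w k → length (extensionsBy i w k) ≡ k
  length-extensionsBy i w zero    = refl
  length-extensionsBy i w (suc k) = cong suc (length-extensionsBy i (w ++ [ i ]) k)

  extensionsBy-extends : ∀ i w k → All (Extends w i) (extensionsBy i w k)
  extensionsBy-extends i w zero    = []
  extensionsBy-extends i w (suc k) =
    ([] , refl) ∷ All.map (extends-trans ([] , refl)) (extensionsBy-extends i (w ++ [ i ]) k)

  extensionsBy-increasing : ∀ i w k → LengthIncreasing (extensionsBy i w k)
  extensionsBy-increasing i w zero    = []
  extensionsBy-increasing i w (suc k) =
    All.map extends-longer (extensionsBy-extends i (w ++ [ i ]) k) ∷ extensionsBy-increasing i (w ++ [ i ]) k

  extensionsBy-bounded : ∀ {d} i w k → LetterBounded d w → occurrences i w + k ≤ d →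
                         All (LetterBounded d) (extensionsBy i w k)
  extensionsBy-bounded i w zero    _       _    = []
  extensionsBy-bounded {d} i w (suc k) bounded room =
    bounded′ ∷ extensionsBy-bounded i (w ++ [ i ]) k bounded′ room′
    where
    bounded′ : LetterBounded d (w ++ [ i ])
    bounded′ = letterBounded-snoc w i bounded (<-≤-trans (m<m+n _ (s≤s z≤n)) room)
    room′ : occurrences i (w ++ [ i ]) + k ≤ d
    room′ = subst (_≤ d) (trans (+-suc _ k) (cong (_+ k) (sym (occurrences-snoc i w)))) room

  neighbours : ℕ → Fin c → Word c → List (Word c)
  neighbours d i w = prefixesBefore i w ++ extensionsBy i w (d ∸ occurrences i w)

  module _ (d : ℕ) (i : Fin c) (w : Word c) where

    length-neighbours : occurrences i w ≤ d → length (neighbours d i w) ≡ d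
    length-neighbours room = begin
      length (neighbours d i w)                       ≡⟨ length-++ (prefixesBefore i w) ⟩
      length (prefixesBefore i w) + length extensions ≡⟨ cong₂ _+_ (length-prefixesBefore i w)
                                                                   (length-extensionsBy i w _) ⟩
      occurrences i w + (d ∸ occurrences i w)         ≡⟨ m+[n∸m]≡n room ⟩
      d                                               ∎
      where
      open ≡-Reasoning
      extensions = extensionsBy i w (d ∸ occurrences i w)

    neighbours-unique : Unique (neighbours d i w)
    neighbours-unique = lengthIncreasing⇒unique (AllPairs.++⁺
      (prefixesBefore-increasing i w)
      (extensionsBy-increasing i w _)
      (All.map (λ ext → All.map (<-trans (extends-longer ext) ∘ extends-longer) (extensionsBy-extends i w _))
               (prefixesBefore-extends i w)))

    neighbours-bounded : LetterBounded d w → All (LetterBounded d) (neighbours d i w)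
    neighbours-bounded bounded = All.++⁺
      (All.map (λ {u} (r , e) → letterBounded-prefix u (i ∷ r) (subst (LetterBounded d) e bounded))
               (prefixesBefore-extends i w))
      (extensionsBy-bounded i w _ bounded (≤-reflexive (m+[n∸m]≡n (bounded i))))

    neighbours-branch : All (λ u → branch w u ≡ just i) (neighbours d i w)
    neighbours-branch = All.++⁺
      (All.map branch-extensionˡ (prefixesBefore-extends i w))
      (All.map branch-extension (extensionsBy-extends i w _))

branchGraph : ∀ {n c} → (Fin n → Word c) → ColGraph n c
branchGraph φ = record
  { col       = λ x y → branch (φ x) (φ y)
  ; loopless  = λ x → branch-self (φ x)
  ; symmetric = λ x y → branch-sym (φ x) (φ y)
  }

InjectiveOnInner : ∀ {n c} → (Fin n → Word c) → Set
InjectiveOnInner φ = ∀ {x y z a} → φ x ≡ φ y → Extends (φ x) a (φ z) → x ≡ y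

minimiser : ∀ {m} (f : Fin (suc m) → ℕ) → ∃[ j₀ ] ∀ j → f j₀ ≤ f j
minimiser f = argmin f zero (allFin _) , λ j → All.lookup (f[argmin]≤f[xs] {f = f} zero (allFin _)) (∈-allFin j)

branchGraph-noPCCycle : ∀ {n c} (φ : Fin n → Word c) → InjectiveOnInner φ → ¬ HasPCCycle (branchGraph φ)
branchGraph-noPCCycle {c = c} φ inner (k , v , v-injective , cl , edge , proper) =
  noCycle (minimiser (length ∘ W))
  where
  W : Fin (3 + k) → Word c
  W = φ ∘ v

  noCycle : ∃[ j₀ ] (∀ j → length (W j₀) ≤ length (W j)) → ⊥
  noCycle (j₀ , shortest) = back (predecessor-reachable j₀ (inj₂ refl) above-next)
    where
    Above : Fin (3 + k) → Set
    Above j = Extends (W j₀) (cl j₀) (W j) ⊎ j ≡ j₀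

    above-next : ∀ j → Above j → Above (next j)
    above-next j (inj₂ refl) with branch-just (W j₀) (W (next j₀)) (edge j₀)
    ... | inj₁ ext = inj₁ ext
    ... | inj₂ ext = contradiction (shortest (next j₀)) (<⇒≱ (extends-longer ext))
    above-next j (inj₁ ext) with branch-just (W j) (W (next j)) (edge j)
    ... | inj₁ ext′ = inj₁ (extends-trans ext ext′)
    ... | inj₂ ext′ with prefixes-comparable ext ext′ (shortest (next j))
    ...   | inj₂ ext″        = inj₁ ext″
    ...   | inj₁ W[next]≡W₀ =
      inj₂ (v-injective (inner W[next]≡W₀ (subst (λ u → Extends u (cl j₀) (W j)) (sym W[next]≡W₀) ext)))

    back : ∃[ p ] next p ≡ j₀ × Above p → ⊥
    back (p , next[p]≡j₀ , inj₂ refl) = contradiction (begin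
      just (cl j₀)                ≡⟨ edge j₀ ⟨
      branch (W j₀) (W (next j₀)) ≡⟨ cong (branch (W j₀) ∘ W) next[p]≡j₀ ⟩
      branch (W j₀) (W j₀)        ≡⟨ branch-self (W j₀) ⟩
      nothing                     ∎) λ ()
      where open ≡-Reasoning
    back (p , next[p]≡j₀ , inj₁ ext) = proper p (just-injective (begin
      just (cl p)               ≡⟨ edge p ⟨
      branch (W p) (W (next p)) ≡⟨ cong (branch (W p) ∘ W) next[p]≡j₀ ⟩
      branch (W p) (W j₀)       ≡⟨ branch-extensionˡ ext ⟩
      just (cl j₀)              ≡⟨ cong (just ∘ cl) next[p]≡j₀ ⟨
      just (cl (next p))        ∎))
      where open ≡-Reasoning

module _ {c : ℕ} (d : ℕ) {n : ℕ} where

  private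
    S : List (Word c)
    S = boundedWords d

    ℓ : Word c
    ℓ = longestBounded {c} {d}

  -- Vertices beyond the number of bounded words become further copies of the longest one.
  wordOf : Fin n → Word c
  wordOf x = nthOr ℓ S (toℕ x)

  wordOf-bounded : ∀ x → LetterBounded d (wordOf x)
  wordOf-bounded x with nthOr-∈ ℓ S (toℕ x)
  ... | inj₁ w∈ = ∈-boundedWords⁻ w∈
  ... | inj₂ eq = subst (LetterBounded d) (sym eq) (longestBounded-bounded {c} {d})

  wordOf-injectiveOnInner : InjectiveOnInner wordOf
  wordOf-injectiveOnInner {x} {y} {z} x≡y ext = toℕ-injective (nthOr-injective ℓ (boundedWords-unique {c} {d})
    (inRange x ext) (inRange y (subst (λ u → Extends u _ _) x≡y ext)) x≡y)
    where
    inRange : ∀ x {a} → Extends (wordOf x) a (wordOf z) → toℕ x < length S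
    inRange x ext = ≰⇒> λ beyond → longestBounded-unextendable {c} {d} (wordOf-bounded z)
      (subst (λ u → Extends u _ _) (nthOr-beyond ℓ S beyond) ext)

  module _ (room : length S ≤ n) where

    wordOf-surjective : ∀ {w} → LetterBounded d w → ∃[ x ] wordOf x ≡ w
    wordOf-surjective {w} bounded = inject≤ (Any.index w∈) room ,
      trans (cong (nthOr ℓ S) (toℕ-inject≤ _ room)) (nthOr-index ℓ w∈)
      where
      w∈ : w ∈ S
      w∈ = ∈-boundedWords⁺ {w = w} bounded

    branchGraph-wordOf-monDeg : MonDegAtLeast (branchGraph wordOf) d
    branchGraph-wordOf-monDeg x i
      with ys , map≡ ← map-preimage wordOf
                         (All.map wordOf-surjective (neighbours-bounded d i (wordOf x) (wordOf-bounded x)))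
      = begin
      d                             ≡⟨ length-neighbours d i w (wordOf-bounded x i) ⟨
      length (neighbours d i w)     ≡⟨ cong length map≡ ⟨
      length (map wordOf ys)        ≡⟨ length-map wordOf ys ⟩
      length ys                     ≤⟨ countCol-≥ _ i unique (All.tabulate (λ {y} _ → ∈-allFin y)) branches ⟩
      degU (branchGraph wordOf) x i ∎
      where
      open ≤-Reasoning
      w = wordOf x
      unique : Unique ys
      unique = Unique.map⁻ (subst Unique (sym map≡) (neighbours-unique d i w))
      branches : All (λ y → branch w (wordOf y) ≡ just i) ys
      branches = All.map⁻ (subst (All _) (sym map≡) (neighbours-branch d i w))

¬UProp : ∀ {n c d} → 2 ≤ c → 2 * c ^ (c * d) ≤ n → ¬ UProp n c d
¬UProp {n} {c} {d} 2≤c 2M≤n admissible =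
  branchGraph-noPCCycle (wordOf d) (wordOf-injectiveOnInner d)
    (admissible (branchGraph (wordOf d)) (branchGraph-wordOf-monDeg d room))
  where
  room : length (boundedWords {c} d) ≤ n
  room = ≤-trans (<⇒≤ (length-boundedWords 2≤c)) 2M≤n

asDigraph : ∀ {n c} → ColGraph n c → ColDigraph n c
asDigraph G = record { col = ColGraph.col G ; loopless = ColGraph.loopless G }

-- A directed 2-cycle would run through one edge in both directions, so it is never properly coloured.
pcDiCycle⇒pcCycle : ∀ {n c} (G : ColGraph n c) → HasPCDiCycle (asDigraph G) → HasPCCycle G
pcDiCycle⇒pcCycle G (zero , v , _ , cl , edge , proper) =
  ⊥-elim (proper zero (just-injective (trans (sym (edge zero)) (trans (ColGraph.symmetric G _ _) (edge (suc zero))))))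
pcDiCycle⇒pcCycle G (suc k , cycle) = k , cycle

DProp⇒UProp : ∀ {n c k} → DProp n c k → UProp n c k
DProp⇒UProp admissible G monDeg = pcDiCycle⇒pcCycle G (admissible (asDigraph G) monDeg)

mainTheorem3 : (c n : ℕ) → 2 ≤ c → 2 ≤ n → (d dvec : ℕ) →
    IsMinimum (UProp n c) d → IsMinimum (DProp n c) dvec →
    d ≤ dvec × LogBound c n d
mainTheorem3 c n 2≤c 2≤n d dvec (d-admissible , d-least) (dvec-admissible , _) =
  d-least dvec (DProp⇒UProp dvec-admissible) ,
  decidable-stable (_ ≤? _) λ ¬bound →
    ¬UProp 2≤c (≮⇒≥ (¬bound ∘ n<2*c^[c*d]⇒logBound d 2≤c 2≤n)) d-admissible
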